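{- Let $p \geq 3$ be a prime number and let $F$ be a one-dimensional cellular automaton over the alphabet $\mathbb{Z}_p$ with diameter $d$ whose local rule $f:\mathbb{Z}_p^{d+1}\to\mathbb{Z}_p$ is of the form $$f(x_1,\dots,x_{d+1})=\sum_{i=1}^{d+1} a_i x_i^{q_i},$$ where each $a_i\in\mathbb{Z}_p$. If every $q_i$ ($i=1,\dots,d+1$) is an even positive integer, then the global map $F$ is not surjective.
   Context: A cellular automaton (CA) over the finite alphabet $A=\mathbb{Z}_m$ is a map $F:A^{\mathbb{Z}}\to A^{\mathbb{Z}}$ for which there are an integer radius $\rho\ge 0$ and a local rule $f:A^{2\rho+1}\to A$ with $F(x)_i=f(x_{i-\rho},\dots,x_{i+\rho})$ for all $x\in A^{\mathbb{Z}}$ and $i\in\mathbb{Z}$; $d=2\rho$ is the diameter, and the arguments of $f$ are indexed $x_1,\dots,x_{d+1}$. All arithmetic in the local rule is modulo $m$ (here $m=p$). $F$ is surjective if it is onto as a map $A^{\mathbb{Z}}\to A^{\mathbb{Z}}$. -}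

module Defs where

open import Data.Nat using (ℕ; zero; suc; _+_; _*_; _^_; NonZero)
open import Data.Nat.DivMod using (_mod_)
open import Data.Fin using (Fin; toℕ) renaming (zero to fz; suc to fs)
open import Data.Integer as ℤ using (ℤ)
open import Relation.Binary.PropositionalEquality using (_≡_)
open import Data.Product using (∃)

ℤ_ : ℕ → Set
ℤ_ p = Fin p

Σ-Fin : (n : ℕ) → (Fin n → ℕ) → ℕ
Σ-Fin zero    g = 0
Σ-Fin (suc n) g = g fz + Σ-Fin n (λ j → g (fs j))

powerSumRule : (p : ℕ) .{{_ : NonZero p}} → (n : ℕ) →
               (a : Fin n → ℤ_ p) → (q : Fin n → ℕ) →
               (Fin n → ℤ_ p) → ℤ_ p
powerSumRule p n a q x = Σ-Fin n (λ i → toℕ (a i) * (toℕ (x i) ^ q i)) mod p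

Config : Set → Set
Config A = ℤ → A

-- Global map of the CA with radius ρ (diameter d = 2ρ) and local rule f:
-- F(x)_i = f(x_{i-ρ}, …, x_{i+ρ}); the argument with index j ∈ Fin (2ρ+1) is x_{i-ρ+j}.
globalMap : {A : Set} (ρ : ℕ) → ((Fin (suc (2 * ρ)) → A) → A) → Config A → Config A
globalMap ρ f x i = f (λ j → x ((i ℤ.- ℤ.+ ρ) ℤ.+ ℤ.+ (toℕ j)))

Surjective : {A : Set} → (Config A → Config A) → Set
Surjective {A} F = (y : Config A) → ∃ λ (x : Config A) → (i : ℤ) → F x i ≡ y i

-- Since every exponent is even, the local rule cannot distinguish a letter x from −x, so F factors
-- through the letter-to-letter map that folds ℤ_p onto the ⌊p/2⌋ + 1 classes {x, −x}. For p ≥ 3 there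
-- are fewer classes than letters, and counting then rules out surjectivity: a word of length n has
-- one of pⁿ values, but is determined by the folded pattern of a preimage on a window of length
-- n + d, which takes at most (⌊p/2⌋ + 1)ⁿ⁺ᵈ values, and this is smaller than pⁿ for large n.
module Submission where

open import Defs
open import Data.Nat using (ℕ; suc; _*_; _≤_; _<_; NonZero)
open import Data.Nat.Divisibility using (_∣_)
open import Data.Nat.Primality using (Prime)
open import Data.Fin using (Fin)
open import Relation.Nullary using (¬_)

open import Data.Nat using (zero; _+_; _^_; _∸_; ⌊_/2⌋; ⌈_/2⌉; z≤n; s≤s; s≤s⁻¹; _≤?_; _<?_)
open import Data.Nat.Properties
open import Data.Nat.DivMod using (_%_; _mod_; m%n<n; %-distribˡ-+; %-distribˡ-*; [m+kn]%n≡m%n)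
open import Data.Nat.Divisibility using (divides)
open import Data.Nat.Tactic.RingSolver using (solve-∀)
import Data.Integer.Tactic.RingSolver as ℤ-RingSolver
open import Data.Fin as Fin using (toℕ; fromℕ<; funToFin; finToFun; combine)
open import Data.Fin.Properties using (injective⇒≤; funToFin-finToFin; finToFun-funToFin; toℕ-fromℕ<; fromℕ<-toℕ; fromℕ<-cong; toℕ<n)
open import Data.Integer as ℤ using (+_; -[1+_])
import Data.Integer.Properties as ℤ
open import Data.Product using (∃; _,_; proj₁; proj₂)
open import Data.Sum using (_⊎_; inj₁; inj₂)
open import Data.Empty using (⊥-elim)
open import Function using (_∘_)
open import Relation.Binary.PropositionalEquality
open import Relation.Nullary using (yes; no)

⌈n/2⌉≤1+⌊n/2⌋ : ∀ n → ⌈ n /2⌉ ≤ suc ⌊ n /2⌋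
⌈n/2⌉≤1+⌊n/2⌋ zero    = z≤n
⌈n/2⌉≤1+⌊n/2⌋ (suc n) = s≤s (⌊n/2⌋-mono (n≤1+n n))

1+⌊n/2⌋<n : ∀ {n} → 3 ≤ n → suc ⌊ n /2⌋ < n
1+⌊n/2⌋<n {suc (suc (suc n))} (s≤s (s≤s (s≤s _))) = s≤s (s≤s (⌊n/2⌋<n n))

⌊n/2⌋<m⇒n∸m≤⌊n/2⌋ : ∀ n {m} → ⌊ n /2⌋ < m → n ∸ m ≤ ⌊ n /2⌋
⌊n/2⌋<m⇒n∸m≤⌊n/2⌋ n {m} h<m = m≤n+o⇒m∸n≤o n m (begin
  n                 ≡⟨ sym (⌊n/2⌋+⌈n/2⌉≡n n) ⟩
  ⌊ n /2⌋ + ⌈ n /2⌉ ≤⟨ +-monoʳ-≤ ⌊ n /2⌋ (≤-trans (⌈n/2⌉≤1+⌊n/2⌋ n) h<m) ⟩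
  ⌊ n /2⌋ + m       ≡⟨ +-comm ⌊ n /2⌋ m ⟩
  m + ⌊ n /2⌋       ∎)
  where open ≤-Reasoning

module _ (p : ℕ) .{{_ : NonZero p}} where

  %-cong-+ : ∀ {a b c d} → a % p ≡ b % p → c % p ≡ d % p → (a + c) % p ≡ (b + d) % p
  %-cong-+ {a} {b} {c} {d} a≡b c≡d = begin
    (a + c) % p             ≡⟨ %-distribˡ-+ a c p ⟩
    (a % p + c % p) % p     ≡⟨ cong₂ (λ u v → (u + v) % p) a≡b c≡d ⟩
    (b % p + d % p) % p     ≡⟨ %-distribˡ-+ b d p ⟨
    (b + d) % p             ∎
    where open ≡-Reasoning

  %-cong-* : ∀ {a b c d} → a % p ≡ b % p → c % p ≡ d % p → (a * c) % p ≡ (b * d) % p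
  %-cong-* {a} {b} {c} {d} a≡b c≡d = begin
    (a * c) % p             ≡⟨ %-distribˡ-* a c p ⟩
    (a % p * (c % p)) % p   ≡⟨ cong₂ (λ u v → (u * v) % p) a≡b c≡d ⟩
    (b % p * (d % p)) % p   ≡⟨ %-distribˡ-* b d p ⟨
    (b * d) % p             ∎
    where open ≡-Reasoning

  %-cong-^ : ∀ {a b} r → a % p ≡ b % p → a ^ r % p ≡ b ^ r % p
  %-cong-^ zero    a≡b = refl
  %-cong-^ (suc r) a≡b = %-cong-* a≡b (%-cong-^ r a≡b)

  %-cong-Σ-Fin : ∀ n {g h : Fin n → ℕ} → (∀ i → g i % p ≡ h i % p) → Σ-Fin n g % p ≡ Σ-Fin n h % p
  %-cong-Σ-Fin zero    g≡h = refl
  %-cong-Σ-Fin (suc n) g≡h = %-cong-+ (g≡h Fin.zero) (%-cong-Σ-Fin n (g≡h ∘ Fin.suc))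

  %-cong-mod : ∀ {a b} → a % p ≡ b % p → a mod p ≡ b mod p
  %-cong-mod {a} {b} a≡b = fromℕ<-cong (a % p) (b % p) a≡b (m%n<n a p) (m%n<n b p)

  %-cong-even-^ : ∀ {a b q} → a ^ 2 % p ≡ b ^ 2 % p → 2 ∣ q → a ^ q % p ≡ b ^ q % p
  %-cong-even-^ {a} {b} a²≡b² (divides r refl) = begin
    a ^ (r * 2) % p    ≡⟨ cong (_% p) (^-[r*2]≡[^2]^r a) ⟩
    (a ^ 2) ^ r % p    ≡⟨ %-cong-^ r a²≡b² ⟩
    (b ^ 2) ^ r % p    ≡⟨ cong (_% p) (^-[r*2]≡[^2]^r b) ⟨
    b ^ (r * 2) % p    ∎
    where
    open ≡-Reasoning
    ^-[r*2]≡[^2]^r : ∀ c → c ^ (r * 2) ≡ (c ^ 2) ^ r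
    ^-[r*2]≡[^2]^r c = trans (cong (c ^_) (*-comm r 2)) (sym (^-*-assoc c 2 r))

  [p∸x]²≡x² : ∀ {x} → x ≤ p → (p ∸ x) ^ 2 % p ≡ x ^ 2 % p
  [p∸x]²≡x² {x} x≤p = begin
    y ^ 2 % p                        ≡⟨ cong (_% p) (^2≡* y) ⟩
    y * y % p                        ≡⟨ [m+kn]%n≡m%n (y * y) (2 * x) p ⟨
    (y * y + 2 * x * p) % p          ≡⟨ cong (λ p′ → (y * y + 2 * x * p′) % p) x+y≡p ⟨
    (y * y + 2 * x * (x + y)) % p    ≡⟨ cong (_% p) (square-identity x y) ⟩
    (x * x + (x + y) * (x + y)) % p  ≡⟨ cong (λ p′ → (x * x + p′ * p′) % p) x+y≡p ⟩
    (x * x + p * p) % p              ≡⟨ [m+kn]%n≡m%n (x * x) p p ⟩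
    x * x % p                        ≡⟨ cong (_% p) (^2≡* x) ⟨
    x ^ 2 % p                        ∎
    where
    open ≡-Reasoning
    y = p ∸ x
    x+y≡p : x + y ≡ p
    x+y≡p = m+[n∸m]≡n x≤p
    ^2≡* : ∀ u → u ^ 2 ≡ u * u
    ^2≡* u = cong (u *_) (*-identityʳ u)
    square-identity : ∀ u v → v * v + 2 * u * (u + v) ≡ u * u + (u + v) * (u + v)
    square-identity = solve-∀

module _ {p : ℕ} where

  fold : Fin p → Fin (suc ⌊ p /2⌋)
  fold x with toℕ x ≤? ⌊ p /2⌋
  ... | yes x≤h = fromℕ< (s≤s x≤h)
  ... | no  x≰h = fromℕ< (s≤s (⌊n/2⌋<m⇒n∸m≤⌊n/2⌋ p (≰⇒> x≰h)))

  toℕ-fold : ∀ x → toℕ (fold x) ≡ toℕ x ⊎ toℕ (fold x) ≡ p ∸ toℕ x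
  toℕ-fold x with toℕ x ≤? ⌊ p /2⌋
  ... | yes _ = inj₁ (toℕ-fromℕ< _)
  ... | no  _ = inj₂ (toℕ-fromℕ< _)

  fold-square : .{{_ : NonZero p}} → ∀ x → toℕ (fold x) ^ 2 % p ≡ toℕ x ^ 2 % p
  fold-square x with toℕ-fold x
  ... | inj₁ eq = cong (λ y → y ^ 2 % p) eq
  ... | inj₂ eq = trans (cong (λ y → y ^ 2 % p) eq) ([p∸x]²≡x² p (<⇒≤ (toℕ<n x)))

powerSumRule-respects-fold : ∀ p .{{_ : NonZero p}} n (a : Fin n → Fin p) (q : Fin n → ℕ) →
  (∀ i → 2 ∣ q i) → (X Y : Fin n → Fin p) → (∀ i → fold (X i) ≡ fold (Y i)) →
  powerSumRule p n a q X ≡ powerSumRule p n a q Y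
powerSumRule-respects-fold p n a q even X Y X≈Y =
  %-cong-mod p (%-cong-Σ-Fin p n {term X} {term Y} λ i →
    %-cong-* p {toℕ (a i)} refl (%-cong-even-^ p (X²≡Y² i) (even i)))
  where
  term : (Fin n → Fin p) → Fin n → ℕ
  term Z i = toℕ (a i) * toℕ (Z i) ^ q i
  X²≡Y² : ∀ i → toℕ (X i) ^ 2 % p ≡ toℕ (Y i) ^ 2 % p
  X²≡Y² i = begin
    toℕ (X i) ^ 2 % p         ≡⟨ fold-square (X i) ⟨
    toℕ (fold (X i)) ^ 2 % p  ≡⟨ cong (λ z → toℕ z ^ 2 % p) (X≈Y i) ⟩
    toℕ (fold (Y i)) ^ 2 % p  ≡⟨ fold-square (Y i) ⟩
    toℕ (Y i) ^ 2 % p         ∎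
    where open ≡-Reasoning

funToFin-cong : ∀ {m n} {f g : Fin m → Fin n} → f ≗ g → funToFin f ≡ funToFin g
funToFin-cong {zero}  _   = refl
funToFin-cong {suc m} f≗g = cong₂ combine (f≗g Fin.zero) (funToFin-cong (f≗g ∘ Fin.suc))

injective⇒^≤^ : ∀ {n p M k} (Φ : (Fin n → Fin p) → (Fin M → Fin k)) →
  (∀ v w → Φ v ≗ Φ w → v ≗ w) → p ^ n ≤ k ^ M
injective⇒^≤^ {n} {p} Φ Φ-injective = injective⇒≤ {f = funToFin ∘ Φ ∘ finToFun} injective
  where
  open ≡-Reasoning
  injective : ∀ {i j} → funToFin (Φ (finToFun i)) ≡ funToFin (Φ (finToFun j)) → i ≡ j
  injective {i} {j} eq = begin
    i                              ≡⟨ funToFin-finToFin {n} {p} i ⟨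
    funToFin (finToFun {p} {n} i)  ≡⟨ funToFin-cong (Φ-injective _ _ Φi≗Φj) ⟩
    funToFin (finToFun {p} {n} j)  ≡⟨ funToFin-finToFin {n} {p} j ⟩
    j                              ∎
    where
    Φi≗Φj : Φ (finToFun i) ≗ Φ (finToFun j)
    Φi≗Φj m = begin
      Φ (finToFun i) m                         ≡⟨ finToFun-funToFin (Φ (finToFun i)) m ⟨
      finToFun (funToFin (Φ (finToFun i))) m   ≡⟨ cong (λ z → finToFun z m) eq ⟩
      finToFun (funToFin (Φ (finToFun j))) m   ≡⟨ finToFun-funToFin (Φ (finToFun j)) m ⟩
      Φ (finToFun j) m                         ∎

k^n*[k+n]≤k*[1+k]^n : ∀ k n → k ^ n * (k + n) ≤ k * suc k ^ n
k^n*[k+n]≤k*[1+k]^n k zero = ≤-reflexive (solve₁ k)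
  where
  solve₁ : ∀ k → 1 * (k + 0) ≡ k * 1
  solve₁ = solve-∀
k^n*[k+n]≤k*[1+k]^n k (suc n) = begin
  k * k ^ n * (k + suc n)                  ≡⟨ solve₁ k (k ^ n) n ⟩
  k * (k ^ n * (k + n)) + k ^ n * k        ≤⟨ +-monoʳ-≤ (k * (k ^ n * (k + n))) (*-monoʳ-≤ (k ^ n) (m≤m+n k n)) ⟩
  k * (k ^ n * (k + n)) + k ^ n * (k + n)  ≡⟨ +-comm (k * (k ^ n * (k + n))) _ ⟩
  suc k * (k ^ n * (k + n))                ≤⟨ *-monoʳ-≤ (suc k) (k^n*[k+n]≤k*[1+k]^n k n) ⟩
  suc k * (k * suc k ^ n)                  ≡⟨ solve₂ k (suc k ^ n) ⟩
  k * (suc k * suc k ^ n)                  ∎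
  where
  open ≤-Reasoning
  solve₁ : ∀ k a n → k * a * (k + suc n) ≡ k * (a * (k + n)) + a * k
  solve₁ = solve-∀
  solve₂ : ∀ k a → suc k * (k * a) ≡ k * (suc k * a)
  solve₂ = solve-∀

eventually-c*k^n<p^n : ∀ c {k p} → k < p → ∃ λ n → c * k ^ n < p ^ n
eventually-c*k^n<p^n c {zero} {p} 0<p = 1 , (begin-strict
  c * 0      ≡⟨ *-zeroʳ c ⟩
  0          <⟨ 0<p ⟩
  p          ≡⟨ *-identityʳ p ⟨
  p * 1      ∎)
  where open ≤-Reasoning
eventually-c*k^n<p^n c {suc h} {p} k<p = n , *-cancelˡ-< k _ _ (begin-strict
  k * (c * k ^ n)  ≡⟨ solve₁ k c (k ^ n) ⟩
  k ^ n * (c * k)  <⟨ *-monoʳ-< (k ^ n) {{m^n≢0 k n}} (m≤n+m n k) ⟩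
  k ^ n * (k + n)  ≤⟨ k^n*[k+n]≤k*[1+k]^n k n ⟩
  k * suc k ^ n    ≤⟨ *-monoʳ-≤ k (^-monoˡ-≤ n k<p) ⟩
  k * p ^ n        ∎)
  where
  open ≤-Reasoning
  k = suc h
  n = suc (c * k)
  solve₁ : ∀ k c a → k * (c * a) ≡ a * (c * k)
  solve₁ = solve-∀

extend : ∀ {A : Set} {n} → A → (Fin n → A) → Config A
extend {n = n} a w (+ j) with j <? n
... | yes j<n = w (fromℕ< j<n)
... | no  _   = a
extend a w -[1+ _ ] = a

extend-toℕ : ∀ {A : Set} {n} (a : A) (w : Fin n → A) j → extend a w (+ toℕ j) ≡ w j
extend-toℕ {n = n} a w j with toℕ j <? n
... | yes j<n = cong w (fromℕ<-toℕ j j<n)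
... | no  j≮n = ⊥-elim (j≮n (toℕ<n j))

+i-+r+t≡+[i+t]-+r : ∀ i r t → (+ i ℤ.- + r) ℤ.+ + t ≡ + (i + t) ℤ.- + r
+i-+r+t≡+[i+t]-+r i r t = trans (swap (+ i) (+ r) (+ t)) (cong (ℤ._- + r) (sym (ℤ.pos-+ i t)))
  where
  swap : ∀ a b c → (a ℤ.- b) ℤ.+ c ≡ (a ℤ.+ c) ℤ.- b
  swap = ℤ-RingSolver.solve-∀

¬surjective-if-rule-factors : ∀ {p k} ρ (f : (Fin (suc (2 * ρ)) → Fin p) → Fin p) (N : Fin p → Fin k) →
  k < p → (∀ X Y → (∀ i → N (X i) ≡ N (Y i)) → f X ≡ f Y) → ¬ Surjective (globalMap ρ f)
¬surjective-if-rule-factors {p} {k} ρ f N k<p f-factors surjective =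
  <⇒≱ k^[n+d]<p^n (injective⇒^≤^ Φ Φ-injective)
  where
  d = 2 * ρ
  n = proj₁ (eventually-c*k^n<p^n (k ^ d) k<p)

  k^[n+d]<p^n : k ^ (n + d) < p ^ n
  k^[n+d]<p^n = begin-strict
    k ^ (n + d)    ≡⟨ ^-distribˡ-+-* k n d ⟩
    k ^ n * k ^ d  ≡⟨ *-comm (k ^ n) (k ^ d) ⟩
    k ^ d * k ^ n  <⟨ proj₂ (eventually-c*k^n<p^n (k ^ d) k<p) ⟩
    p ^ n          ∎
    where open ≤-Reasoning

  target : (Fin n → Fin p) → Config (Fin p)
  target = extend (fromℕ< k<p)

  preimage : (Fin n → Fin p) → Config (Fin p)
  preimage w = proj₁ (surjective (target w))

  Φ : (Fin n → Fin p) → Fin (n + d) → Fin k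
  Φ w m = N (preimage w (+ toℕ m ℤ.- + ρ))

  Φ-injective : ∀ v w → Φ v ≗ Φ w → v ≗ w
  Φ-injective v w Φv≗Φw j = begin
    v j                                   ≡⟨ extend-toℕ _ v j ⟨
    target v (+ toℕ j)                    ≡⟨ proj₂ (surjective (target v)) (+ toℕ j) ⟨
    globalMap ρ f (preimage v) (+ toℕ j)  ≡⟨ f-factors _ _ same-window ⟩
    globalMap ρ f (preimage w) (+ toℕ j)  ≡⟨ proj₂ (surjective (target w)) (+ toℕ j) ⟩
    target w (+ toℕ j)                    ≡⟨ extend-toℕ _ w j ⟩
    w j                                   ∎
    where
    open ≡-Reasoning
    same-window : ∀ t → N (preimage v ((+ toℕ j ℤ.- + ρ) ℤ.+ + toℕ t))
                      ≡ N (preimage w ((+ toℕ j ℤ.- + ρ) ℤ.+ + toℕ t))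
    same-window t = subst (λ i → N (preimage v i) ≡ N (preimage w i)) (sym position) (Φv≗Φw m)
      where
      m : Fin (n + d)
      m = fromℕ< (+-mono-<-≤ (toℕ<n j) (s≤s⁻¹ (toℕ<n t)))
      position : (+ toℕ j ℤ.- + ρ) ℤ.+ + toℕ t ≡ + toℕ m ℤ.- + ρ
      position = trans (+i-+r+t≡+[i+t]-+r (toℕ j) ρ (toℕ t)) (cong (λ i → + i ℤ.- + ρ) (sym (toℕ-fromℕ< _)))

lemma2 : (p : ℕ) .{{_ : NonZero p}} → Prime p → 3 ≤ p →
    (ρ : ℕ) (a : Fin (suc (2 * ρ)) → ℤ_ p) (q : Fin (suc (2 * ρ)) → ℕ) →
    (∀ i → 2 ∣ q i) → (∀ i → 0 < q i) →
    ¬ Surjective (globalMap ρ (powerSumRule p (suc (2 * ρ)) a q))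
lemma2 p _ p≥3 ρ a q even _ =
  ¬surjective-if-rule-factors ρ _ fold (1+⌊n/2⌋<n p≥3) (powerSumRule-respects-fold p (suc (2 * ρ)) a q even)
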